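{- Let $\mathcal{G}=\{G_1,\dots,G_k\}$ be an untimed directed evolving graph with $G_i=(V,E_i)$, and let $\mu=\max_i |E_i|$. For every vertex $v\in V$, let $\mathcal{P}(v)=\{u\in V : u \overset{st}{\leadsto} v\}$ be the set of strict predecessors of $v$. Then $|\mathcal{P}(v)|\le k\mu$ for every $v\in V$; that is, a vertex cannot have more than $k\mu$ predecessors.
   Context: An untimed directed evolving graph is a finite sequence $\mathcal{G}=\{G_1,\dots,G_k\}$ of directed graphs $G_i=(V,E_i)$ on a common vertex set $V$; $k=|\mathcal{G}|$ is the number of steps. A strict journey from $u$ to $v$ is a nonempty sequence of arcs $e_1=(x_0,x_1), e_2=(x_1,x_2),\dots,e_p=(x_{p-1},x_p)$ with $x_0=u$, $x_p=v$, together with step indices $i_1<i_2<\dots<i_p$ such that $e_j\in E_{i_j}$ for all $j$ (at most one arc is traversed per step). We write $u \overset{st}{\leadsto} v$ if a strict journey from $u$ to $v$ exists. -}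

module Defs where

open import Data.Nat using (ℕ; zero; suc; _<_; _⊔_)
open import Data.Fin using (Fin; toℕ)
open import Data.Product using (_×_; _,_)
open import Data.List using (List; length; foldr; map; allFin)
open import Data.List.Membership.Propositional using (_∈_)
open import Data.List.Relation.Unary.Unique.Propositional using (Unique)

Arc : ℕ → Set
Arc n = Fin n × Fin n

record EvolvingGraph (n k : ℕ) : Set where
  field
    arcs   : Fin k → List (Arc n)
    unique : ∀ i → Unique (arcs i)
open EvolvingGraph public

edgeCount : ∀ {n k} → EvolvingGraph n k → Fin k → ℕ
edgeCount G i = length (arcs G i)

-- μ = max_i |E_i|  (0 when k = 0)
μ : ∀ {n k} → EvolvingGraph n k → ℕ
μ {k = k} G = foldr _⊔_ 0 (map (edgeCount G) (allFin k))

-- StrictJourneyFrom G i u v : a nonempty strict journey from u to v whose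
-- first arc is used at step i and subsequent arcs at strictly later steps.
data StrictJourneyFrom {n k : ℕ} (G : EvolvingGraph n k) :
       Fin k → Fin n → Fin n → Set where
  last : ∀ {i u v} → (u , v) ∈ arcs G i → StrictJourneyFrom G i u v
  step : ∀ {i j u w v} → (u , w) ∈ arcs G i → toℕ i < toℕ j →
         StrictJourneyFrom G j w v → StrictJourneyFrom G i u v

data _⊢_↝st_ {n k : ℕ} (G : EvolvingGraph n k) (u v : Fin n) : Set where
  journey : (i : Fin k) → StrictJourneyFrom G i u v → G ⊢ u ↝st v

module Submission where

-- Every strict predecessor u of v starts a strict journey, whose first arc
-- (u , w) lies in some arc set E_i.  Hence u occurs in the list of tails
--   tails G = concat_i (tails of the arcs of E_i),
-- a list of length Σ_i |E_i| ≤ k μ.  Since the given list of predecessors is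
-- duplicate-free and contained in tails G, it is no longer than tails G.

open import Defs
open import Data.Nat using (ℕ; _≤_; _+_; _*_; _⊔_; suc; z≤n; s≤s)
open import Data.Nat.Properties using (≤-trans; +-mono-≤; m≤m⊔n; m≤n⊔m)
open import Data.Fin using (Fin)
open import Data.Product using (_,_; proj₁; proj₂; ∃-syntax)
open import Data.List using (List; []; _∷_; length; map; foldr; allFin; concatMap)
open import Data.List.Properties using (length-++; length-map; length-removeAt′; length-tabulate)
open import Data.List.Relation.Unary.Any using (here; there)
open import Data.List.Relation.Unary.All as All using (All; []; _∷_)
open import Data.List.Relation.Unary.AllPairs using (_∷_)
open import Data.List.Relation.Unary.Unique.Propositional using (Unique)
open import Data.List.Membership.Propositional using (_∈_; _─_; lose)
open import Data.List.Membership.Propositional.Properties using (∈-map⁺; ∈-allFin; ∈-concatMap⁺)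
open import Relation.Binary.PropositionalEquality using (_≢_; refl; sym; subst)
open import Data.Empty using (⊥-elim)

module _ {A : Set} where

  ∈-─ : {x y : A} (ys : List A) (x∈ys : x ∈ ys) → y ∈ ys → y ≢ x → y ∈ ys ─ x∈ys
  ∈-─ (_ ∷ _)  (here refl) (here refl) y≢x = ⊥-elim (y≢x refl)
  ∈-─ (_ ∷ _)  (here _)    (there y∈)  _   = y∈
  ∈-─ (_ ∷ _)  (there _)   (here refl) _   = here refl
  ∈-─ (_ ∷ ys) (there x∈)  (there y∈)  y≢x = there (∈-─ ys x∈ y∈ y≢x)

  -- Remove the head x of xs from ys and recurse; the other elements
  -- of xs differ from x, so they survive the removal.
  unique-⊆-length : (xs ys : List A) → Unique xs → All (_∈ ys) xs →
                    length xs ≤ length ys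
  unique-⊆-length []       ys _              _            = z≤n
  unique-⊆-length (x ∷ xs) ys (x∉xs ∷ uniq) (x∈ys ∷ xs⊆ys) =
    subst (suc (length xs) ≤_) (sym (length-removeAt′ ys _))
      (s≤s (unique-⊆-length xs (ys ─ x∈ys) uniq (survive xs x∉xs xs⊆ys)))
    where
      survive : (zs : List A) → All (x ≢_) zs → All (_∈ ys) zs →
                All (_∈ ys ─ x∈ys) zs
      survive []       []            []            = []
      survive (z ∷ zs) (x≢z ∷ x≢zs) (z∈ys ∷ zs⊆ys) =
        ∈-─ ys x∈ys z∈ys (λ z≡x → x≢z (sym z≡x)) ∷ survive zs x≢zs zs⊆ys

length-concatMap-≤ : {A B : Set} (f : A → List B) (M : ℕ) (xs : List A) →
                     All (λ x → length (f x) ≤ M) xs →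
                     length (concatMap f xs) ≤ length xs * M
length-concatMap-≤ f M []       []               = z≤n
length-concatMap-≤ f M (x ∷ xs) (fx≤M ∷ fxs≤M) =
  subst (_≤ M + length xs * M) (sym (length-++ (f x)))
    (+-mono-≤ fx≤M (length-concatMap-≤ f M xs fxs≤M))

≤-foldr-⊔ : {m : ℕ} (ns : List ℕ) → m ∈ ns → m ≤ foldr _⊔_ 0 ns
≤-foldr-⊔ (n ∷ ns) (here refl) = m≤m⊔n n _
≤-foldr-⊔ (n ∷ ns) (there m∈)  = ≤-trans (≤-foldr-⊔ ns m∈) (m≤n⊔m n _)

edgeCount≤μ : ∀ {n k} (G : EvolvingGraph n k) (i : Fin k) → edgeCount G i ≤ μ G
edgeCount≤μ G i = ≤-foldr-⊔ _ (∈-map⁺ (edgeCount G) (∈-allFin i))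

tailsAt : ∀ {n k} → EvolvingGraph n k → Fin k → List (Fin n)
tailsAt G i = map proj₁ (arcs G i)

tails : ∀ {n k} → EvolvingGraph n k → List (Fin n)
tails {k = k} G = concatMap (tailsAt G) (allFin k)

length-tails : ∀ {n k} (G : EvolvingGraph n k) → length (tails G) ≤ k * μ G
length-tails {k = k} G =
  subst (λ m → length (tails G) ≤ m * μ G) (length-tabulate {n = k} (λ i → i))
    (length-concatMap-≤ (tailsAt G) (μ G) (allFin k)
      (All.tabulate (λ {i} _ → tailsAt≤μ i)))
  where
    tailsAt≤μ : (i : Fin k) → length (tailsAt G i) ≤ μ G
    tailsAt≤μ i =
      subst (_≤ μ G) (sym (length-map proj₁ (arcs G i))) (edgeCount≤μ G i)

predecessor∈tails : ∀ {n k} (G : EvolvingGraph n k) {u v : Fin n} →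
                    G ⊢ u ↝st v → u ∈ tails G
predecessor∈tails G (journey i J) =
  ∈-concatMap⁺ (tailsAt G) (lose (∈-allFin i) (∈-map⁺ proj₁ (proj₂ (firstArc J))))
  where
    firstArc : ∀ {i u v} → StrictJourneyFrom G i u v → ∃[ w ] (u , w) ∈ arcs G i
    firstArc (last uv∈)     = _ , uv∈
    firstArc (step uw∈ _ _) = _ , uw∈

mainTheorem1 : (n k : ℕ) (G : EvolvingGraph n k) (v : Fin n)
    (ps : List (Fin n)) → Unique ps → All (λ u → G ⊢ u ↝st v) ps →
    length ps ≤ k * μ G
mainTheorem1 n k G v ps unique-ps preds =
  ≤-trans (unique-⊆-length ps (tails G) unique-ps
            (All.map (predecessor∈tails G) preds))
          (length-tails G)
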